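{- The construction $\mathbf{P}$ is a functor from the category of monoids to the category of clones: for every monoid $M$, $\mathbf{P}(M)$ is a clone; for every monoid morphism $\phi:M\to M'$, $\mathbf{P}(\phi)$ is a clone morphism; $\mathbf{P}(\phi'\circ\phi)=\mathbf{P}(\phi')\circ\mathbf{P}(\phi)$ and $\mathbf{P}(\mathrm{id}_M)=\mathrm{id}_{\mathbf{P}(M)}$. Moreover, this functor preserves injections and surjections: if $\phi$ is injective (resp. surjective), then $\mathbf{P}(\phi)$ is injective (resp. surjective).
   Context: A clone $C$ is a graded set $\bigsqcup_{n\ge0}C(n)$ with superposition maps $C(n)\times C(m)^n\to C(m)$, $x[y_1,\dots,y_n]$, and projections $\mathbf{1}_{i,n}\in C(n)$ ($n\ge1$, $i\in[n]$) satisfying $\mathbf{1}_{i,n}[y_1,\dots,y_n]=y_i$, $x[\mathbf{1}_{1,n},\dots,\mathbf{1}_{n,n}]=x$ and $x[y_1,\dots,y_n][z_1,\dots,z_m]=x[y_1[z_1,\dots,z_m],\dots,y_n[z_1,\dots,z_m]]$. A clone morphism is an arity-preserving map sending projections to projections and commuting with superposition. For a monoid $(M,\cdot,e)$: an $M$-pigmented letter is a pair $i^\alpha$ with $i$ a positive integer and $\alpha\in M$; $\mathbf{P}(M)(n)$ is the set of words of $M$-pigmented letters with values in $[n]$. For $\alpha\in M$, $\alpha\odot i_1^{\alpha_1}\cdots i_\ell^{\alpha_\ell}:=i_1^{\alpha\cdot\alpha_1}\cdots i_\ell^{\alpha\cdot\alpha_\ell}$. Superposition: $i_1^{\alpha_1}\cdots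 i_\ell^{\alpha_\ell}[\mathfrak{p}_1,\dots,\mathfrak{p}_n]:=(\alpha_1\odot\mathfrak{p}_{i_1})\cdots(\alpha_\ell\odot\mathfrak{p}_{i_\ell})$ (concatenation); projections $\mathbf{1}_{i,n}:=i^e$. For a monoid morphism $\phi:M\to M'$, $\mathbf{P}(\phi)(i_1^{\alpha_1}\cdots i_\ell^{\alpha_\ell}):=i_1^{\phi(\alpha_1)}\cdots i_\ell^{\phi(\alpha_\ell)}$. -}

module Defs where

open import Data.Nat using (ℕ)
open import Data.Fin using (Fin)
open import Data.List using (List; []; _∷_; _++_; map; concatMap)
open import Data.Product using (_×_; _,_; Σ)
open import Function using (_∘_; Injective; Surjective)
open import Relation.Binary.PropositionalEquality using (_≡_)

record Monoid : Set₁ where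
  field
    Carrier  : Set
    _·_      : Carrier → Carrier → Carrier
    e        : Carrier
    assoc    : ∀ x y z → (x · y) · z ≡ x · (y · z)
    identityˡ : ∀ x → e · x ≡ x
    identityʳ : ∀ x → x · e ≡ x

open Monoid public using (Carrier)

record IsMonoidMorphism (M M' : Monoid) (φ : Carrier M → Carrier M') : Set where
  field
    preserves-· : ∀ x y → φ (Monoid._·_ M x y) ≡ Monoid._·_ M' (φ x) (φ y)
    preserves-e : φ (Monoid.e M) ≡ Monoid.e M'

-- Clones.  Arity n, the set [n] is Fin n (so projections exist only for
-- n ≥ 1, as Fin 0 is empty); a tuple (y₁,…,yₙ) is a function Fin n → C m.

record CloneOps : Set₁ where
  field
    C    : ℕ → Set
    sup  : ∀ {n m} → C n → (Fin n → C m) → C m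
    proj : ∀ {n} → Fin n → C n

record IsClone (K : CloneOps) : Set where
  open CloneOps K
  field
    proj-sup : ∀ {n m} (i : Fin n) (ys : Fin n → C m) → sup (proj i) ys ≡ ys i
    sup-proj : ∀ {n} (x : C n) → sup x proj ≡ x
    sup-assoc : ∀ {n m k} (x : C n) (ys : Fin n → C m) (zs : Fin m → C k) →
                sup (sup x ys) zs ≡ sup x (λ i → sup (ys i) zs)

record IsCloneMorphism (K L : CloneOps) (f : ∀ n → CloneOps.C K n → CloneOps.C L n) : Set where
  field
    preserves-proj : ∀ {n} (i : Fin n) → f n (CloneOps.proj K i) ≡ CloneOps.proj L i
    preserves-sup  : ∀ {n m} (x : CloneOps.C K n) (ys : Fin n → CloneOps.C K m) →
                     f m (CloneOps.sup K x ys) ≡ CloneOps.sup L (f n x) (λ i → f m (ys i))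

-- An M-pigmented letter i^α with i ∈ [n] is a pair (i , α)
PWord : Monoid → ℕ → Set
PWord M n = List (Fin n × Carrier M)

_⊙_ : ∀ {M n} → Carrier M → PWord M n → PWord M n
_⊙_ {M} α w = map (λ { (i , β) → i , Monoid._·_ M α β }) w

P-sup : ∀ {M n m} → PWord M n → (Fin n → PWord M m) → PWord M m
P-sup {M} w ps = concatMap (λ { (i , α) → _⊙_ {M} α (ps i) }) w

P-proj : ∀ {M n} → Fin n → PWord M n
P-proj {M} i = (i , Monoid.e M) ∷ []

P : Monoid → CloneOps
P M = record { C = PWord M ; sup = P-sup {M} ; proj = P-proj {M} }

P-map : ∀ {M M'} → (Carrier M → Carrier M') → ∀ n → PWord M n → PWord M' n
P-map φ n w = map (λ { (i , α) → i , φ α }) w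

{-# OPTIONS --safe #-}
module Submission where

-- A pigmented word is a list of letters, the pigment action α ⊙_ and P(φ) are maps over that
-- list, and superposition is a concatMap.  The clone laws thus reduce to the monoid laws
-- letterwise together with the interaction of map and concatMap with _++_, and functoriality
-- and the preservation of injections and surjections are those of List.map.

open import Defs
open import Data.Fin using (Fin)
open import Data.List using ([]; _∷_; [_]; _++_; map; concatMap)
open import Data.List.Properties
  using (++-identityʳ; map-cong; map-∘; map-id; map-injective;
         concatMap-++; concatMap-cong; concatMap-pure; concatMap-map; map-concatMap)
open import Data.Product using (_×_; _,_; map₂)
open import Data.Product.Properties using (,-injectiveˡ; ,-injectiveʳ)
open import Function using (_∘_; id; Injective; Surjective; StrictlySurjective)
open import Function.Consequences.Propositional
  using (strictlySurjective⇒surjective; surjective⇒strictlySurjective)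
open import Relation.Binary.PropositionalEquality using (_≡_; refl; cong; cong₂; sym)
open Relation.Binary.PropositionalEquality.≡-Reasoning

module _ {A B : Set} where

  map-strictlySurjective : {f : A → B} → StrictlySurjective _≡_ f →
                           StrictlySurjective _≡_ (map f)
  map-strictlySurjective surj [] = [] , refl
  map-strictlySurjective surj (y ∷ ys) with surj y | map-strictlySurjective surj ys
  ... | x , refl | xs , refl = x ∷ xs , refl

  map₂-injective : {I : Set} {f : A → B} → Injective _≡_ _≡_ f →
                   Injective _≡_ _≡_ (map₂ {A = I} f)
  map₂-injective inj eq = cong₂ _,_ (,-injectiveˡ eq) (inj (,-injectiveʳ eq))

  map₂-strictlySurjective : {I : Set} {f : A → B} → StrictlySurjective _≡_ f →
                            StrictlySurjective _≡_ (map₂ {A = I} f)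
  map₂-strictlySurjective surj (i , y) with surj y
  ... | x , refl = (i , x) , refl

module PigmentAction (M : Monoid) where
  open Monoid M

  private
    _⊙ᴹ_ : ∀ {n} → Carrier M → PWord M n → PWord M n
    _⊙ᴹ_ = _⊙_ {M}

    sup : ∀ {n m} → PWord M n → (Fin n → PWord M m) → PWord M m
    sup = P-sup {M}

  ⊙-identityˡ : ∀ {n} (w : PWord M n) → e ⊙ᴹ w ≡ w
  ⊙-identityˡ w = begin
    map (map₂ (e ·_)) w ≡⟨ map-cong (λ { (i , β) → cong (i ,_) (identityˡ β) }) w ⟩
    map id w            ≡⟨ map-id w ⟩
    w                   ∎

  ⊙-⊙ : ∀ {n} α β (w : PWord M n) → α ⊙ᴹ (β ⊙ᴹ w) ≡ (α · β) ⊙ᴹ w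
  ⊙-⊙ α β w = begin
    map (map₂ (α ·_)) (map (map₂ (β ·_)) w) ≡⟨ map-∘ w ⟨
    map (map₂ ((α ·_) ∘ (β ·_))) w         ≡⟨ map-cong (λ { (i , γ) → cong (i ,_) (sym (assoc α β γ)) }) w ⟩
    map (map₂ ((α · β) ·_)) w              ∎

  P-sup-⊙ : ∀ {n m} α (w : PWord M n) (zs : Fin n → PWord M m) →
            sup (α ⊙ᴹ w) zs ≡ α ⊙ᴹ sup w zs
  P-sup-⊙ α w zs = begin
    concatMap (λ { (i , β) → β ⊙ᴹ zs i }) (map (map₂ (α ·_)) w) ≡⟨ concatMap-map _ _ w ⟩
    concatMap (λ { (i , β) → (α · β) ⊙ᴹ zs i }) w               ≡⟨ concatMap-cong (λ { (i , β) → sym (⊙-⊙ α β (zs i)) }) w ⟩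
    concatMap (λ { (i , β) → α ⊙ᴹ (β ⊙ᴹ zs i) }) w             ≡⟨ map-concatMap _ _ w ⟨
    α ⊙ᴹ sup w zs                                               ∎

  P-proj-sup : ∀ {n m} (i : Fin n) (ys : Fin n → PWord M m) → sup (P-proj {M} i) ys ≡ ys i
  P-proj-sup i ys = begin
    e ⊙ᴹ ys i ++ [] ≡⟨ ++-identityʳ _ ⟩
    e ⊙ᴹ ys i       ≡⟨ ⊙-identityˡ (ys i) ⟩
    ys i            ∎

  P-sup-proj : ∀ {n} (x : PWord M n) → sup x (P-proj {M}) ≡ x
  P-sup-proj x = begin
    concatMap (λ { (i , α) → [ i , α · e ] }) x ≡⟨ concatMap-cong (λ { (i , α) → cong (λ β → [ i , β ]) (identityʳ α) }) x ⟩
    concatMap [_] x                               ≡⟨ concatMap-pure x ⟩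
    x                                             ∎

  P-sup-assoc : ∀ {n m k} (x : PWord M n) (ys : Fin n → PWord M m) (zs : Fin m → PWord M k) →
                sup (sup x ys) zs ≡ sup x (λ i → sup (ys i) zs)
  P-sup-assoc [] ys zs = refl
  P-sup-assoc ((i , α) ∷ x) ys zs = begin
    sup (α ⊙ᴹ ys i ++ sup x ys) zs             ≡⟨ concatMap-++ _ (α ⊙ᴹ ys i) (sup x ys) ⟩
    sup (α ⊙ᴹ ys i) zs ++ sup (sup x ys) zs    ≡⟨ cong₂ _++_ (P-sup-⊙ α (ys i) zs) (P-sup-assoc x ys zs) ⟩
    α ⊙ᴹ sup (ys i) zs ++ sup x (λ j → sup (ys j) zs) ∎

  P-isClone : IsClone (P M)
  P-isClone = record
    { proj-sup  = P-proj-sup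
    ; sup-proj  = P-sup-proj
    ; sup-assoc = P-sup-assoc
    }

module PigmentMap {M M' : Monoid} {φ : Carrier M → Carrier M'}
                  (isMorphism : IsMonoidMorphism M M' φ) where
  open IsMonoidMorphism isMorphism

  private
    Pφ : ∀ n → PWord M n → PWord M' n
    Pφ = P-map {M} {M'} φ

  P-map-⊙ : ∀ {n} α (w : PWord M n) → Pφ n (_⊙_ {M} α w) ≡ _⊙_ {M'} (φ α) (Pφ n w)
  P-map-⊙ α w = begin
    map (map₂ φ) (map (map₂ (Monoid._·_ M α)) w) ≡⟨ map-∘ w ⟨
    map (map₂ (φ ∘ Monoid._·_ M α)) w           ≡⟨ map-cong (λ { (i , β) → cong (i ,_) (preserves-· α β) }) w ⟩
    map (map₂ (Monoid._·_ M' (φ α) ∘ φ)) w      ≡⟨ map-∘ w ⟩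
    map (map₂ (Monoid._·_ M' (φ α))) (map (map₂ φ) w) ∎

  P-map-sup : ∀ {n m} (x : PWord M n) (ys : Fin n → PWord M m) →
              Pφ m (P-sup {M} x ys) ≡ P-sup {M'} (Pφ n x) (λ i → Pφ m (ys i))
  P-map-sup {m = m} x ys = begin
    map (map₂ φ) (P-sup {M} x ys)                                ≡⟨ map-concatMap _ _ x ⟩
    concatMap (λ { (i , α) → Pφ m (_⊙_ {M} α (ys i)) }) x         ≡⟨ concatMap-cong (λ { (i , α) → P-map-⊙ α (ys i) }) x ⟩
    concatMap (λ { (i , α) → _⊙_ {M'} (φ α) (Pφ m (ys i)) }) x    ≡⟨ concatMap-map _ _ x ⟨
    P-sup {M'} (Pφ _ x) (λ i → Pφ m (ys i))                       ∎

  P-map-isCloneMorphism : IsCloneMorphism (P M) (P M') Pφ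
  P-map-isCloneMorphism = record
    { preserves-proj = λ i → cong (λ α → [ i , α ]) preserves-e
    ; preserves-sup  = P-map-sup
    }

theorem3p2p1 :
    ((M : Monoid) → IsClone (P M))
    × ((M M' : Monoid) (φ : Carrier M → Carrier M') →
        IsMonoidMorphism M M' φ → IsCloneMorphism (P M) (P M') (P-map {M} {M'} φ))
    × ((M M' M'' : Monoid) (φ : Carrier M → Carrier M') (φ' : Carrier M' → Carrier M'') →
        IsMonoidMorphism M M' φ → IsMonoidMorphism M' M'' φ' →
        ∀ n (w : PWord M n) →
          P-map {M} {M''} (φ' ∘ φ) n w ≡ P-map {M'} {M''} φ' n (P-map {M} {M'} φ n w))
    × ((M : Monoid) → ∀ n (w : PWord M n) → P-map {M} {M} id n w ≡ w)
    × ((M M' : Monoid) (φ : Carrier M → Carrier M') →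
        IsMonoidMorphism M M' φ → Injective _≡_ _≡_ φ →
        ∀ n → Injective _≡_ _≡_ (P-map {M} {M'} φ n))
    × ((M M' : Monoid) (φ : Carrier M → Carrier M') →
        IsMonoidMorphism M M' φ → Surjective _≡_ _≡_ φ →
        ∀ n → Surjective _≡_ _≡_ (P-map {M} {M'} φ n))
theorem3p2p1 =
  PigmentAction.P-isClone ,
  (λ M M' φ → PigmentMap.P-map-isCloneMorphism) ,
  (λ M M' M'' φ φ' _ _ n → map-∘) ,
  (λ M n → map-id) ,
  (λ M M' φ _ inj n → map-injective (map₂-injective inj)) ,
  (λ M M' φ _ surj n → strictlySurjective⇒surjective
     (map-strictlySurjective (map₂-strictlySurjective (surjective⇒strictlySurjective surj))))
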